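{- Let $f:\{0,\dots,n\}\to\mathbb{R}_{\ge0}$ be non-decreasing and concave with $f(0)=0$, $f(1)=1$, extended by linear interpolation to $[0,n]$ and by $f(x)=f(n)$ for $x\ge n$. Let $0<\varepsilon\le\frac13$ with $1/\varepsilon$ an integer, $n>1/\varepsilon$, and let $0=k_0<k_1<\dots<k_\ell=n$ be the sequence defined in the context. Let $(C,k_p)$ be a feasible extended configuration, i.e., a configuration $C$ of $n_C$ large items together with an index $p$ such that $n_C\le k_p$, and let $n(C,k_p)=k_t$ where $t$ is the smallest index with $k_p-n_C\le k_t$. Then a bin packed according to $(C,k_p)$, i.e., containing the $n_C$ large items of $C$ together with at most $n(C,k_p)$ small items, has cost at most $(1+\varepsilon)f(k_p)$; that is, $f(n_C+a)\le(1+\varepsilon)f(k_p)$ for every integer $0\le a\le n(C,k_p)$.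
   Context: The sequence $k_j$: $k_j=j$ for $j=0,1,\dots,1/\varepsilon$; for $j\ge1/\varepsilon$, $k_{j+1}$ is the maximum integer $t'$ with $k_j<t'\le n$ and $f(t')\le(1+\varepsilon)f(k_j)$; the sequence stops at $k_\ell=n$. (Such $t'$ exists since $f(j+1)\le(1+\varepsilon)f(j)$ for $j\ge1/\varepsilon$.) A configuration is a multiset of large items (items of size at least $\varepsilon$) of total size at most $1$.
   Formalization: The function f takes values in the nonnegative rationals instead of ℝ≥0, and the sizes of the large items in the configuration C are rational. -}

module Defs where

open import Data.Nat as ℕ using (ℕ; zero; suc; NonZero; _⊓_; _∸_)
open import Data.Integer using (+_)
open import Data.Rational using (ℚ; 0ℚ; 1ℚ; _+_; _-_; _*_; _/_; _≤_)
open import Data.List using (List; foldr; length)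
open import Data.List.Relation.Unary.All using (All)
open import Data.Product using (_×_)
open import Relation.Binary.PropositionalEquality using (_≡_)
open import Relation.Nullary using (¬_)

eps : (m : ℕ) → .{{NonZero m}} → ℚ
eps m = + 1 / m

NonDecreasingOn : ℕ → (ℕ → ℚ) → Set
NonDecreasingOn n f = ∀ i j → i ℕ.≤ j → j ℕ.≤ n → f i ≤ f j

-- f concave on {0,…,n} (equivalently, its linear interpolation on [0,n] is concave):
-- successive differences are non-increasing
ConcaveOn : ℕ → (ℕ → ℚ) → Set
ConcaveOn n f = ∀ j → suc (suc j) ℕ.≤ n → f (suc (suc j)) - f (suc j) ≤ f (suc j) - f j

fext : ℕ → (ℕ → ℚ) → ℕ → ℚ
fext n f x = f (x ⊓ n)

-- k : ℕ → ℕ with last index ℓ is the sequence k_0,…,k_ℓ of the paper (ε = 1/m)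
record KSeq (m n : ℕ) .{{_ : NonZero m}} (f : ℕ → ℚ) (ℓ : ℕ) (k : ℕ → ℕ) : Set where
  field
    initial : ∀ j → j ℕ.≤ m → k j ≡ j
    step-gt : ∀ j → m ℕ.≤ j → j ℕ.< ℓ → k j ℕ.< k (suc j)
    step-le : ∀ j → m ℕ.≤ j → j ℕ.< ℓ → k (suc j) ℕ.≤ n
    step-ok : ∀ j → m ℕ.≤ j → j ℕ.< ℓ → f (k (suc j)) ≤ (1ℚ + eps m) * f (k j)
    step-max : ∀ j → m ℕ.≤ j → j ℕ.< ℓ → ∀ t' → k (suc j) ℕ.< t' → t' ℕ.≤ n →
               ¬ (f t' ≤ (1ℚ + eps m) * f (k j))
    last : k ℓ ≡ n

sumℚ : List ℚ → ℚ
sumℚ = foldr _+_ 0ℚ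

-- a configuration: multiset (list) of large item sizes (each ≥ ε) of total size ≤ 1
IsConfiguration : (m : ℕ) → .{{NonZero m}} → List ℚ → Set
IsConfiguration m C = All (λ s → eps m ≤ s) C × sumℚ C ≤ 1ℚ

{-# OPTIONS --safe #-}
module Submission where

-- Concavity makes increments shrink under translation: f (c + y) - f (c + x) ≤ f y - f x for
-- x ≤ y.  So f y ≤ (1 + ε) f x gives f (c + y) ≤ f (c + x) + ε f x ≤ (1 + ε) f (c + x).  Apply this
-- with c = n_C, x = k_s, y = k_(s+1) = k_t: minimality of t gives n_C + k_s < k_p, hence
-- f (n_C + k_s) ≤ f (k_p).  In the initial segment k_(s+1) = k_s + 1, and minimality alone
-- gives n_C + k_t ≤ k_p.

open import Defs
open import Data.Nat using (ℕ; NonZero; _∸_; _+_; zero; suc; _⊓_; z≤n; _≤′_; ≤′-refl; ≤′-step)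
  renaming (_≤_ to _≤ℕ_; _<_ to _<ℕ_)
open import Data.Rational using (ℚ; 0ℚ; 1ℚ; _≤_; -_; _-_; nonNegative)
  renaming (_+_ to _+ℚ_; _*_ to _*ℚ_)
open import Data.List using (List; length)
open import Relation.Binary.PropositionalEquality
  using (_≡_; refl; sym; trans; cong; cong₂; subst; subst₂)
open import Relation.Nullary using (yes; no)
open import Data.Empty using (⊥-elim)
import Data.Nat.Properties as ℕₚ
import Data.Rational.Properties as ℚₚ
open import Data.Rational.Solver using (module +-*-Solver)
open import Algebra.Properties.CommutativeSemigroup ℕₚ.+-commutativeSemigroup using (x∙yz≈y∙xz)
open +-*-Solver

*-monoˡ-≤-0≤ : ∀ {r p q} → 0ℚ ≤ r → p ≤ q → r *ℚ p ≤ r *ℚ q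
*-monoˡ-≤-0≤ {r} 0≤r = ℚₚ.*-monoˡ-≤-nonNeg r {{nonNegative 0≤r}}

p≤[1+q]*p : ∀ {p q} → 0ℚ ≤ q → 0ℚ ≤ p → p ≤ (1ℚ +ℚ q) *ℚ p
p≤[1+q]*p {p} {q} 0≤q 0≤p =
  subst₂ _≤_ (lhs p q) (rhs p q) (ℚₚ.+-monoʳ-≤ p (*-monoˡ-≤-0≤ 0≤q 0≤p))
  where
  lhs : ∀ p q → p +ℚ q *ℚ 0ℚ ≡ p
  lhs = solve 2 (λ p q → p :+ q :* con 0ℚ := p) refl
  rhs : ∀ p q → p +ℚ q *ℚ p ≡ (1ℚ +ℚ q) *ℚ p
  rhs = solve 2 (λ p q → p :+ q :* p := (con 1ℚ :+ q) :* p) refl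

0≤1+q : ∀ {q} → 0ℚ ≤ q → 0ℚ ≤ 1ℚ +ℚ q
0≤1+q 0≤q = ℚₚ.+-mono-≤ (ℚₚ.nonNegative⁻¹ 1ℚ) 0≤q

0≤eps : ∀ m .{{_ : NonZero m}} → 0ℚ ≤ eps m
0≤eps m = ℚₚ.nonNegative⁻¹ _ {{ℚₚ.normalize-nonNeg 1 m}}

increment : (ℕ → ℚ) → ℕ → ℕ → ℚ
increment g d z = g (d + z) - g z

ConcaveSeq : (ℕ → ℚ) → Set
ConcaveSeq g = ∀ j → increment g 1 (suc j) ≤ increment g 1 j

increment-suc : ∀ g d z → increment g (suc d) z ≡ increment g 1 (d + z) +ℚ increment g d z
increment-suc g d z = telescope (g (suc (d + z))) (g (d + z)) (g z)
  where
  telescope : ∀ u v w → u - w ≡ (u - v) +ℚ (v - w)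
  telescope = solve 3 (λ u v w → u :- w := (u :- v) :+ (v :- w)) refl

module _ {g : ℕ → ℚ} (concave : ConcaveSeq g) where

  unit-increment-antitone : ∀ {i j} → i ≤ℕ j → increment g 1 j ≤ increment g 1 i
  unit-increment-antitone i≤j = go (ℕₚ.≤⇒≤′ i≤j)
    where
    go : ∀ {i j} → i ≤′ j → increment g 1 j ≤ increment g 1 i
    go ≤′-refl = ℚₚ.≤-refl
    go (≤′-step {j} i≤′j) = ℚₚ.≤-trans (concave j) (go i≤′j)

  increment-antitone : ∀ d {y z} → y ≤ℕ z → increment g d z ≤ increment g d y
  increment-antitone zero {y} {z} _ =
    ℚₚ.≤-reflexive (trans (ℚₚ.+-inverseʳ (g z)) (sym (ℚₚ.+-inverseʳ (g y))))
  increment-antitone (suc d) {y} {z} y≤z =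
    subst₂ _≤_ (sym (increment-suc g d z)) (sym (increment-suc g d y))
      (ℚₚ.+-mono-≤ (unit-increment-antitone (ℕₚ.+-monoʳ-≤ d y≤z)) (increment-antitone d y≤z))

  shift-preserves-growth : (∀ {i j} → i ≤ℕ j → g i ≤ g j) →
    ∀ {ε} → 0ℚ ≤ ε → ∀ {x y} → x ≤ℕ y → g y ≤ (1ℚ +ℚ ε) *ℚ g x →
    ∀ c → g (c + y) ≤ (1ℚ +ℚ ε) *ℚ g (c + x)
  shift-preserves-growth mono {ε} 0≤ε {x} {y} x≤y gy≤ c = begin
    g (c + y)                               ≡⟨ cong g (sym shifted) ⟩
    g (d + (c + x))                         ≡⟨ add-back (g (d + (c + x))) (g (c + x)) ⟩
    g (c + x) +ℚ increment g d (c + x)      ≤⟨ ℚₚ.+-monoʳ-≤ (g (c + x))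
                                                 (increment-antitone d (ℕₚ.m≤n+m x c)) ⟩
    g (c + x) +ℚ increment g d x            ≡⟨ cong (λ w → g (c + x) +ℚ (g w - g x))
                                                 (ℕₚ.m∸n+n≡m x≤y) ⟩
    g (c + x) +ℚ (g y - g x)                ≤⟨ ℚₚ.+-monoʳ-≤ (g (c + x)) (ℚₚ.+-monoˡ-≤ (- g x) gy≤) ⟩
    g (c + x) +ℚ ((1ℚ +ℚ ε) *ℚ g x - g x)  ≡⟨ cong (g (c + x) +ℚ_) (excess (g x)) ⟩
    g (c + x) +ℚ ε *ℚ g x                   ≤⟨ ℚₚ.+-monoʳ-≤ (g (c + x))
                                                 (*-monoˡ-≤-0≤ 0≤ε (mono (ℕₚ.m≤n+m x c))) ⟩
    g (c + x) +ℚ ε *ℚ g (c + x)             ≡⟨ factor (g (c + x)) ⟩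
    (1ℚ +ℚ ε) *ℚ g (c + x)                  ∎
    where
    open ℚₚ.≤-Reasoning
    d = y ∸ x
    shifted : d + (c + x) ≡ c + y
    shifted = trans (x∙yz≈y∙xz d c x) (cong (c +_) (ℕₚ.m∸n+n≡m x≤y))
    add-back : ∀ u v → u ≡ v +ℚ (u - v)
    add-back = solve 2 (λ u v → u := v :+ (u :- v)) refl
    excess : ∀ u → (1ℚ +ℚ ε) *ℚ u - u ≡ ε *ℚ u
    excess u = solve 2 (λ u ε → (con 1ℚ :+ ε) :* u :- u := ε :* u) refl u ε
    factor : ∀ u → u +ℚ ε *ℚ u ≡ (1ℚ +ℚ ε) *ℚ u
    factor u = solve 2 (λ u ε → u :+ ε :* u := (con 1ℚ :+ ε) :* u) refl u ε

m<o∸n⇒n+m<o : ∀ {m n o} → n ≤ℕ o → m <ℕ o ∸ n → n + m <ℕ o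
m<o∸n⇒n+m<o {m} {n} {o} n≤o m<o∸n =
  subst (_≤ℕ o) (trans (ℕₚ.+-comm (suc m) n) (ℕₚ.+-suc n m))
    (ℕₚ.m≤o∸n⇒m+n≤o (suc m) n≤o m<o∸n)

module _ {n : ℕ} {f : ℕ → ℚ} where

  fext≡f : ∀ {i} → i ≤ℕ n → fext n f i ≡ f i
  fext≡f i≤n = cong f (ℕₚ.m≤n⇒m⊓n≡m i≤n)

  fext-beyond : ∀ {i} → n ≤ℕ i → fext n f i ≡ f n
  fext-beyond n≤i = cong f (ℕₚ.m≥n⇒m⊓n≡n n≤i)

  module _ (nondecreasing : NonDecreasingOn n f) where

    fext-mono : ∀ {i j} → i ≤ℕ j → fext n f i ≤ fext n f j
    fext-mono {i} {j} i≤j = nondecreasing (i ⊓ n) (j ⊓ n) (ℕₚ.⊓-monoˡ-≤ n i≤j) (ℕₚ.m⊓n≤n j n)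

    fext-concave : ConcaveOn n f → ConcaveSeq (fext n f)
    fext-concave concave j with suc (suc j) ℕₚ.≤? n
    ... | yes j+2≤n = subst₂ _≤_
      (cong₂ _-_ (sym (fext≡f j+2≤n)) (sym (fext≡f j+1≤n)))
      (cong₂ _-_ (sym (fext≡f j+1≤n)) (sym (fext≡f (ℕₚ.≤-trans (ℕₚ.n≤1+n j) j+1≤n))))
      (concave j j+2≤n)
      where
      j+1≤n = ℕₚ.≤-trans (ℕₚ.n≤1+n (suc j)) j+2≤n
    ... | no j+2≰n = begin
      fext n f (suc (suc j)) - fext n f (suc j)  ≡⟨ cong (_- fext n f (suc j)) flat ⟩
      fext n f (suc j) - fext n f (suc j)        ≤⟨ ℚₚ.+-monoʳ-≤ (fext n f (suc j))
                                                      (ℚₚ.neg-antimono-≤ (fext-mono (ℕₚ.n≤1+n j))) ⟩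
      fext n f (suc j) - fext n f j              ∎
      where
      open ℚₚ.≤-Reasoning
      n≤j+1 = ℕₚ.≤-pred (ℕₚ.≰⇒> j+2≰n)
      flat : fext n f (suc (suc j)) ≡ fext n f (suc j)
      flat = trans (fext-beyond (ℕₚ.m≤n⇒m≤1+n n≤j+1)) (sym (fext-beyond n≤j+1))

module _ {m n : ℕ} .{{_ : NonZero m}} {f : ℕ → ℚ} {ℓ : ℕ} {k : ℕ → ℕ} (ks : KSeq m n f ℓ k)
  where
  open KSeq ks

  k-suc-initial : ∀ {s} → s <ℕ m → k (suc s) ≡ suc (k s)
  k-suc-initial {s} s<m = trans (initial (suc s) s<m) (cong suc (sym (initial s (ℕₚ.<⇒≤ s<m))))

  k≤n : m <ℕ n → ∀ {j} → j ≤ℕ ℓ → k j ≤ℕ n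
  k≤n m<n {j} j≤ℓ with j ℕₚ.≤? m
  ... | yes j≤m = subst (_≤ℕ n) (sym (initial j j≤m)) (ℕₚ.≤-trans j≤m (ℕₚ.<⇒≤ m<n))
  k≤n m<n {suc s} j≤ℓ | no j≰m = step-le s (ℕₚ.≤-pred (ℕₚ.≰⇒> j≰m)) j≤ℓ
  k≤n m<n {zero} j≤ℓ | no 0≰m = ⊥-elim (0≰m z≤n)

  module _ (m<n : m <ℕ n) (nonneg : ∀ i → i ≤ℕ n → 0ℚ ≤ f i)
           (nondecreasing : NonDecreasingOn n f) (concave : ConcaveOn n f)
           {c p : ℕ} (p≤ℓ : p ≤ℕ ℓ) (c≤kp : c ≤ℕ k p) where

    kp≤n : k p ≤ℕ n
    kp≤n = k≤n m<n p≤ℓ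

    fext≤f[kp] : ∀ {x} → x ≤ℕ k p → fext n f x ≤ f (k p)
    fext≤f[kp] x≤kp = subst (fext n f _ ≤_) (fext≡f {f = f} kp≤n) (fext-mono nondecreasing x≤kp)

    fext≤[1+ε]f[kp] : ∀ {x} → x ≤ℕ k p → fext n f x ≤ (1ℚ +ℚ eps m) *ℚ f (k p)
    fext≤[1+ε]f[kp] x≤kp =
      ℚₚ.≤-trans (fext≤f[kp] x≤kp) (p≤[1+q]*p (0≤eps m) (nonneg (k p) kp≤n))

    fext-step-ok : ∀ {s} → m ≤ℕ s → s <ℕ ℓ →
      fext n f (k (suc s)) ≤ (1ℚ +ℚ eps m) *ℚ fext n f (k s)
    fext-step-ok {s} m≤s s<ℓ = subst₂ _≤_
      (sym (fext≡f {f = f} (step-le s m≤s s<ℓ)))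
      (cong ((1ℚ +ℚ eps m) *ℚ_) (sym (fext≡f {f = f} (k≤n m<n (ℕₚ.<⇒≤ s<ℓ)))))
      (step-ok s m≤s s<ℓ)

    shifted-k-bound : ∀ {t} → t ≤ℕ ℓ → (∀ t' → t' <ℕ t → k t' <ℕ k p ∸ c) →
      fext n f (c + k t) ≤ (1ℚ +ℚ eps m) *ℚ f (k p)
    shifted-k-bound {zero} _ _ = fext≤[1+ε]f[kp] (begin
      c + k 0  ≡⟨ cong (c +_) (initial 0 z≤n) ⟩
      c + 0    ≡⟨ ℕₚ.+-identityʳ c ⟩
      c        ≤⟨ c≤kp ⟩
      k p      ∎)
      where open ℕₚ.≤-Reasoning
    shifted-k-bound {suc s} t≤ℓ below with m ℕₚ.≤? s
    ... | no s≱m = fext≤[1+ε]f[kp] (begin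
      c + k (suc s)  ≡⟨ cong (c +_) (k-suc-initial (ℕₚ.≰⇒> s≱m)) ⟩
      c + suc (k s)  ≡⟨ ℕₚ.+-suc c (k s) ⟩
      suc (c + k s)  ≤⟨ m<o∸n⇒n+m<o c≤kp (below s (ℕₚ.n<1+n s)) ⟩
      k p            ∎)
      where open ℕₚ.≤-Reasoning
    ... | yes m≤s = ℚₚ.≤-trans
      (shift-preserves-growth (fext-concave nondecreasing concave) (fext-mono nondecreasing)
        (0≤eps m) (ℕₚ.<⇒≤ (step-gt s m≤s t≤ℓ)) (fext-step-ok m≤s t≤ℓ) c)
      (*-monoˡ-≤-0≤ (0≤1+q (0≤eps m))
        (fext≤f[kp] (ℕₚ.<⇒≤ (m<o∸n⇒n+m<o c≤kp (below s (ℕₚ.n<1+n s))))))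

corollary1 : (n m : ℕ) .{{_ : NonZero m}} (f : ℕ → ℚ) →
    3 ≤ℕ m → m <ℕ n →
    (∀ i → i ≤ℕ n → 0ℚ ≤ f i) → NonDecreasingOn n f → ConcaveOn n f →
    f 0 ≡ 0ℚ → f 1 ≡ 1ℚ →
    (ℓ : ℕ) (k : ℕ → ℕ) → KSeq m n f ℓ k →
    (C : List ℚ) → IsConfiguration m C →
    (p : ℕ) → p ≤ℕ ℓ → length C ≤ℕ k p →
    (t : ℕ) → t ≤ℕ ℓ → k p ∸ length C ≤ℕ k t → (∀ t' → t' <ℕ t → k t' <ℕ k p ∸ length C) →
    ∀ a → a ≤ℕ k t → fext n f (length C + a) ≤ (1ℚ +ℚ eps m) *ℚ f (k p)
corollary1 _ _ _ _ m<n nonneg nondecreasing concave _ _ _ _ ks C _ _ p≤ℓ nC≤kp _ t≤ℓ _ below _ a≤kt =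
  ℚₚ.≤-trans (fext-mono nondecreasing (ℕₚ.+-monoʳ-≤ (length C) a≤kt))
             (shifted-k-bound ks m<n nonneg nondecreasing concave p≤ℓ nC≤kp t≤ℓ below)
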